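{- Let $t\ge 1$ and $\mathbf{m}=(m_1,\dots,m_t)$ with positive integers $m_1\ge m_2\ge\cdots\ge m_t$ all of the same parity. Then \[ N(CB(\mathbf{m}))=F(\mathbf{m}):=\sum_{j=0}^{m_t}\binom{m_t}{j}\prod_{k=1}^{t-1}\binom{m_k}{\frac12(m_k-m_t)+j}. \]
   Context: For $\mathbf{m}\in\mathbb{N}^t$, $CB(\mathbf{m})$ is the graph consisting of two distinct vertices joined by $t$ internally vertex-disjoint paths of lengths $m_1,\dots,m_t$. For a finite connected graph $G=(V,E)$ (possibly with parallel edges, which occur in $CB(\mathbf{m})$ when two paths have length $1$), $N(G)$ denotes the number of functions $f:V\to\mathbb{Z}$, taken modulo adding a common constant, such that $|f(u)-f(v)|\le1$ for every edge $uv$ and the edges with $|f(u)-f(v)|=1$ form a connected spanning subgraph of $G$. For simple $G$ this equals the number of facets of the symmetric edge polytope $P_G=\operatorname{conv}\{\pm(e_i-e_j):\{i,j\}\in E\}$. -}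

module Defs where

open import Data.Nat using (ℕ; zero; suc; _+_; _*_; _∸_; _/_; pred; _<?_)
open import Data.Nat.Combinatorics using (_C_)
open import Data.Fin using (Fin; zero; suc; toℕ; fromℕ<; inject₁; fromℕ)
open import Data.Integer using (ℤ; ∣_∣) renaming (_+_ to _+ℤ_; _-_ to _-ℤ_)
open import Data.Product using (Σ; _×_; _,_; proj₁; proj₂)
open import Data.Sum using (_⊎_)
open import Relation.Nullary using (yes; no)
open import Relation.Binary.PropositionalEquality using (_≡_)
open import Level using (0ℓ) renaming (suc to lsuc)

record Graph : Set₁ where
  field
    V    : Set
    E    : Set
    ends : E → V × V

module _ (G : Graph) where
  open Graph G

  Lipschitz : (V → ℤ) → Set
  Lipschitz f = (e : E) → ∣ f (proj₁ (ends e)) -ℤ f (proj₂ (ends e)) ∣ Data.Nat.≤ 1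

  Tight : (V → ℤ) → E → Set
  Tight f e = ∣ f (proj₁ (ends e)) -ℤ f (proj₂ (ends e)) ∣ ≡ 1

  data TReach (f : V → ℤ) : V → V → Set where
    here  : ∀ {u} → TReach f u u
    fwd   : ∀ {u} (e : E) → Tight f e →
            TReach f (proj₂ (ends e)) u → TReach f (proj₁ (ends e)) u
    bwd   : ∀ {u} (e : E) → Tight f e →
            TReach f (proj₁ (ends e)) u → TReach f (proj₂ (ends e)) u

  TightConnected : (V → ℤ) → Set
  TightConnected f = (u v : V) → TReach f u v

  Valid : (V → ℤ) → Set
  Valid f = Lipschitz f × TightConnected f

  _∼_ : (V → ℤ) → (V → ℤ) → Set
  f ∼ g = Σ ℤ λ c → (v : V) → f v ≡ g v +ℤ c

  -- N(G) = n : there are exactly n classes of valid functions modulo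
  -- constants, i.e. a family of n valid representatives, one per class.
  N≡ : ℕ → Set
  N≡ n = Σ (Fin n → (V → ℤ)) λ g →
           ((i : Fin n) → Valid (g i))
         × ((f : V → ℤ) → Valid f → Σ (Fin n) λ i → f ∼ g i)
         × ((i j : Fin n) → g i ∼ g j → i ≡ j)

-- The graph CB(m): endpoints a, b and t internally disjoint paths,
-- path k of length m k having m k - 1 internal vertices.

data CBV (t : ℕ) (m : Fin t → ℕ) : Set where
  a b   : CBV t m
  inner : (k : Fin t) → Fin (pred (m k)) → CBV t m

pos : ∀ {t m} (k : Fin t) → ℕ → CBV t m
pos k zero = a
pos {m = m} k (suc i) with i <? pred (m k)
... | yes p = inner k (fromℕ< p)
... | no _  = b

CB : (t : ℕ) → (Fin t → ℕ) → Graph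
CB t m = record
  { V    = CBV t m
  ; E    = Σ (Fin t) λ k → Fin (m k)
  ; ends = λ { (k , i) → pos k (toℕ i) , pos k (suc (toℕ i)) }
  }

sumTo : ℕ → (ℕ → ℕ) → ℕ
sumTo zero    h = h 0
sumTo (suc n) h = sumTo n h + h (suc n)

prodFin : (n : ℕ) → (Fin n → ℕ) → ℕ
prodFin zero    h = 1
prodFin (suc n) h = h zero * prodFin n (λ k → h (suc k))

-- m : Fin (suc s) → ℕ, t = s + 1, m_t = m (fromℕ s)
F : (s : ℕ) → (Fin (suc s) → ℕ) → ℕ
F s m = sumTo mt λ j → (mt C j) * prodFin s (λ k → m (inject₁ k) C (((m (inject₁ k) ∸ mt) / 2) + j))
  where mt = m (fromℕ s)

-- Let f be valid and call an edge flat if f is constant on it.  A path carrying two flat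
-- edges would cut off the segment between them, and a flat edge on every path would separate
-- a from b; so every path has at most one flat edge and some path has none.  Along path k,
-- f(b) - f(a) ≡ m_k - (number of flat edges) (mod 2), and all m_k have the same parity, so no
-- path has a flat edge: every edge is tight.  Normalising f(a) = 0, a valid f is therefore the
-- same as a ±1-word on every path, all with the same sum f(b).  If the word on the last path
-- has j up-steps, the word on path k must have (m_k - m_t)/2 + j of them, and counting these
-- choices of words is exactly the sum F(m).

module Submission where

open import Defs
open import Data.Nat using (ℕ; zero; suc; pred; _+_; _*_; _∸_; _/_; _%_; _≤_; _<_; z≤n; s≤s; _≤?_; _<?_)
import Data.Nat.Properties as ℕ
import Data.Nat.Divisibility as ℕ
open import Data.Nat.DivMod using (m≡m%n+[m/n]*n; m/n*n≡m)
open import Data.Nat.Combinatorics using (_C_; nCk+nC[k+1]≡[n+1]C[k+1])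
open import Data.Integer using (ℤ; +_; -[1+_]; ∣_∣) renaming (_+_ to _+ℤ_; _-_ to _-ℤ_; _*_ to _*ℤ_)
import Data.Integer.Properties as ℤ
open import Data.Integer.Divisibility.Signed using (_∣_; divides; ∣⇒∣ᵤ; ∣m∣n⇒∣m+n; ∣m∣n⇒∣m-n)
open import Data.Integer.Tactic.RingSolver using (solve-∀)
open import Data.Fin using (Fin; zero; suc; toℕ; fromℕ; fromℕ<; inject₁)
import Data.Fin.Properties as Fin
open import Data.Product using (Σ; ∃; _×_; _,_; proj₁; proj₂)
open import Data.Sum using (_⊎_; inj₁; inj₂)
open import Data.Unit using (⊤; tt)
open import Data.Empty using (⊥-elim)
open import Data.Bool using (Bool; true; false; _∧_; not)
open import Data.Bool.Properties using (∧-zeroʳ; ∧-identityʳ)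
open import Data.Vec using (Vec; []; _∷_; lookup; tabulate)
open import Data.Vec.Properties using (tabulate-cong; tabulate∘lookup)
open import Function.Bundles using (_↔_; mk↔ₛ′; Inverse)
open import Function.Properties.Inverse using (↔-refl; ↔-trans)
open import Data.Sum.Function.Propositional using (_⊎-↔_)
open import Data.Product.Function.NonDependent.Propositional using (_×-↔_)
open import Data.Product.Function.Dependent.Propositional using (Σ-↔)
open import Relation.Nullary using (¬_; yes; no; does)
open import Relation.Nullary.Decidable using (dec-true; dec-false)
open import Relation.Binary.PropositionalEquality using (_≡_; _≢_; refl; sym; trans; cong; cong₂; subst)
open Relation.Binary.PropositionalEquality.≡-Reasoning

-- Counting by explicit bijections

ones : ∀ {L} → Vec Bool L → ℕ
ones []          = 0
ones (true ∷ v)  = suc (ones v)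
ones (false ∷ v) = ones v

Words : ℕ → ℕ → Set
Words L u = Σ (Vec Bool L) λ v → ones v ≡ u

Words-≡ : ∀ {L u} {w w′ : Words L u} → proj₁ w ≡ proj₁ w′ → w ≡ w′
Words-≡ {w = v , p} {.v , q} refl = cong (v ,_) (ℕ.≡-irrelevant p q)

Words-0-0 : Fin 1 ↔ Words 0 0
Words-0-0 = mk↔ₛ′ (λ _ → [] , refl) (λ _ → zero) (λ { ([] , refl) → refl }) (λ { zero → refl })

Words-0-suc : ∀ u → Fin 0 ↔ Words 0 (suc u)
Words-0-suc u = mk↔ₛ′ (λ ()) (λ { ([] , ()) }) (λ { ([] , ()) }) (λ ())

Words-suc-0 : ∀ L → Words L 0 ↔ Words (suc L) 0
Words-suc-0 L = mk↔ₛ′ (λ { (v , p) → false ∷ v , p }) (λ { (false ∷ v , p) → v , p ; (true ∷ _ , ()) })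
  (λ { (false ∷ v , p) → refl ; (true ∷ _ , ()) }) (λ { (v , p) → refl })

Words-suc-suc : ∀ L u → (Words L u ⊎ Words L (suc u)) ↔ Words (suc L) (suc u)
Words-suc-suc L u = mk↔ₛ′ to from (λ { (true ∷ v , p) → Words-≡ refl ; (false ∷ v , p) → refl })
                                  (λ { (inj₁ (v , p)) → cong inj₁ (Words-≡ refl) ; (inj₂ _) → refl })
  where
  to : Words L u ⊎ Words L (suc u) → Words (suc L) (suc u)
  to (inj₁ (v , p)) = true ∷ v , cong suc p
  to (inj₂ (v , p)) = false ∷ v , p
  from : Words (suc L) (suc u) → Words L u ⊎ Words L (suc u)
  from (true ∷ v , p)  = inj₁ (v , ℕ.suc-injective p)
  from (false ∷ v , p) = inj₂ (v , p)

C↔Words : ∀ L u → Fin (L C u) ↔ Words L u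
C↔Words zero    zero    = Words-0-0
C↔Words zero    (suc u) = Words-0-suc u
C↔Words (suc L) zero    = ↔-trans (C↔Words L zero) (Words-suc-0 L)
C↔Words (suc L) (suc u) =
  subst (λ n → Fin n ↔ Words (suc L) (suc u)) (nCk+nC[k+1]≡[n+1]C[k+1] L u)
    (↔-trans Fin.+↔⊎ (↔-trans (C↔Words L u ⊎-↔ C↔Words L (suc u)) (Words-suc-suc L u)))

Tuple : (n : ℕ) → (Fin n → Set) → Set
Tuple zero    A = ⊤
Tuple (suc n) A = A zero × Tuple n (λ k → A (suc k))

lookupᵗ : ∀ {n A} → Tuple n A → (k : Fin n) → A k
lookupᵗ (x , _)  zero    = x
lookupᵗ (_ , xs) (suc k) = lookupᵗ xs k

tabulateᵗ : ∀ n {A : Fin n → Set} → ((k : Fin n) → A k) → Tuple n A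
tabulateᵗ zero    g = tt
tabulateᵗ (suc n) g = g zero , tabulateᵗ n (λ k → g (suc k))

lookup-tabulateᵗ : ∀ n {A : Fin n → Set} (g : (k : Fin n) → A k) k → lookupᵗ (tabulateᵗ n g) k ≡ g k
lookup-tabulateᵗ (suc n) g zero    = refl
lookup-tabulateᵗ (suc n) g (suc k) = lookup-tabulateᵗ n (λ k → g (suc k)) k

Tuple-ext : ∀ n {A : Fin n → Set} {xs ys : Tuple n A} → (∀ k → lookupᵗ xs k ≡ lookupᵗ ys k) → xs ≡ ys
Tuple-ext zero    _  = refl
Tuple-ext (suc n) eq = cong₂ _,_ (eq zero) (Tuple-ext n (λ k → eq (suc k)))

Tuple-↔ : ∀ n {A B : Fin n → Set} → (∀ k → A k ↔ B k) → Tuple n A ↔ Tuple n B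
Tuple-↔ zero    f = ↔-refl
Tuple-↔ (suc n) f = f zero ×-↔ Tuple-↔ n (λ k → f (suc k))

prodFin↔Tuple : ∀ n (h : Fin n → ℕ) → Fin (prodFin n h) ↔ Tuple n (λ k → Fin (h k))
prodFin↔Tuple zero    h = mk↔ₛ′ (λ _ → tt) (λ _ → zero) (λ _ → refl) (λ { zero → refl })
prodFin↔Tuple (suc n) h = ↔-trans Fin.*↔× (↔-refl ×-↔ prodFin↔Tuple n (λ k → h (suc k)))

prodFin-last : ∀ n (h : Fin (suc n) → ℕ) →
               prodFin (suc n) h ≡ prodFin n (λ k → h (inject₁ k)) * h (fromℕ n)
prodFin-last zero    h = ℕ.*-comm (h zero) 1
prodFin-last (suc n) h = trans (cong (h zero *_) (prodFin-last n (λ k → h (suc k))))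
                               (sym (ℕ.*-assoc (h zero) _ _))

sumTo-cong : ∀ n {g h : ℕ → ℕ} → (∀ j → g j ≡ h j) → sumTo n g ≡ sumTo n h
sumTo-cong zero    eq = eq 0
sumTo-cong (suc n) eq = cong₂ _+_ (sumTo-cong n eq) (eq (suc n))

Σ≤ : ℕ → (ℕ → Set) → Set
Σ≤ n X = Σ ℕ λ j → j ≤ n × X j

Σ≤-zero : ∀ (X : ℕ → Set) → X 0 ↔ Σ≤ 0 X
Σ≤-zero X = mk↔ₛ′ (λ x → 0 , z≤n , x) (λ { (zero , z≤n , x) → x })
                  (λ { (zero , z≤n , x) → refl }) (λ _ → refl)

Σ≤-suc : ∀ n (X : ℕ → Set) → (Σ≤ n X ⊎ X (suc n)) ↔ Σ≤ (suc n) X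
Σ≤-suc n X = mk↔ₛ′ to from to∘from from∘to
  where
  to : Σ≤ n X ⊎ X (suc n) → Σ≤ (suc n) X
  to (inj₁ (j , j≤n , x)) = j , ℕ.m≤n⇒m≤1+n j≤n , x
  to (inj₂ x)             = suc n , ℕ.≤-refl , x
  from : Σ≤ (suc n) X → Σ≤ n X ⊎ X (suc n)
  from (j , j≤1+n , x) with ℕ.m≤n⇒m<n∨m≡n j≤1+n
  ... | inj₁ (s≤s j≤n) = inj₁ (j , j≤n , x)
  ... | inj₂ refl      = inj₂ x
  to∘from : ∀ y → to (from y) ≡ y
  to∘from (j , j≤1+n , x) with ℕ.m≤n⇒m<n∨m≡n j≤1+n
  ... | inj₁ (s≤s j≤n) = cong (λ p → j , p , x) (ℕ.≤-irrelevant _ _)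
  ... | inj₂ refl      = cong (λ p → suc n , p , x) (ℕ.≤-irrelevant _ _)
  from∘to : ∀ y → from (to y) ≡ y
  from∘to (inj₁ (j , j≤n , x)) with ℕ.m≤n⇒m<n∨m≡n (ℕ.m≤n⇒m≤1+n j≤n)
  ... | inj₁ (s≤s j≤n′) = cong (λ p → inj₁ (j , p , x)) (ℕ.≤-irrelevant _ _)
  ... | inj₂ refl       = ⊥-elim (ℕ.n≮n _ j≤n)
  from∘to (inj₂ x) with ℕ.m≤n⇒m<n∨m≡n (ℕ.≤-refl {suc n})
  ... | inj₁ n<n = ⊥-elim (ℕ.n≮n _ n<n)
  ... | inj₂ refl = refl

Σ≤-↔ : ∀ n {X Y : ℕ → Set} → (∀ j → X j ↔ Y j) → Σ≤ n X ↔ Σ≤ n Y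
Σ≤-↔ n f = Σ-↔ ↔-refl (↔-refl ×-↔ f _)

sumTo↔Σ≤ : ∀ n (h : ℕ → ℕ) → Fin (sumTo n h) ↔ Σ≤ n (λ j → Fin (h j))
sumTo↔Σ≤ zero    h = Σ≤-zero _
sumTo↔Σ≤ (suc n) h = ↔-trans Fin.+↔⊎ (↔-trans (sumTo↔Σ≤ n h ⊎-↔ ↔-refl) (Σ≤-suc n _))

ones≤length : ∀ {L} (v : Vec Bool L) → ones v ≤ L
ones≤length []              = z≤n
ones≤length (true ∷ v)  = s≤s (ones≤length v)
ones≤length (false ∷ v) = ℕ.m≤n⇒m≤1+n (ones≤length v)

-- Parity

2∤1 : ¬ (+ 2 ∣ + 1)
2∤1 2∣1 with ℕ.∣1⇒≡1 (∣⇒∣ᵤ 2∣1)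
... | ()

≤1∧≢0⇒≡1 : ∀ {x} → x ≤ 1 → x ≢ 0 → x ≡ 1
≤1∧≢0⇒≡1 {zero}  _         x≢0 = ⊥-elim (x≢0 refl)
≤1∧≢0⇒≡1 {suc zero} _      _   = refl
≤1∧≢0⇒≡1 {suc (suc _)} (s≤s ()) _

2∣n∧n<2⇒n≡0 : ∀ {n} → + 2 ∣ + n → n < 2 → n ≡ 0
2∣n∧n<2⇒n≡0 {zero}        _   _              = refl
2∣n∧n<2⇒n≡0 {suc zero}    2∣1 _              = ⊥-elim (2∤1 2∣1)
2∣n∧n<2⇒n≡0 {suc (suc _)} _   (s≤s (s≤s ()))

%2≡⇒n≡m%2+[n/2]*2 : ∀ {m n} → m % 2 ≡ n % 2 → n ≡ m % 2 + n / 2 * 2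
%2≡⇒n≡m%2+[n/2]*2 {m} {n} eq = trans (m≡m%n+[m/n]*n n 2) (cong (_+ n / 2 * 2) (sym eq))

%2≡⇒2∣[+m]-[+n] : ∀ {m n} → m % 2 ≡ n % 2 → + 2 ∣ + m -ℤ + n
%2≡⇒2∣[+m]-[+n] {m} {n} eq = divides (+ (m / 2) -ℤ + (n / 2)) (begin
  + m -ℤ + n                                      ≡⟨ cong₂ (λ x y → + x -ℤ + y) (m≡m%n+[m/n]*n m 2)
                                                                                (%2≡⇒n≡m%2+[n/2]*2 {m} {n} eq) ⟩
  + (m % 2 + m / 2 * 2) -ℤ + (m % 2 + n / 2 * 2)  ≡⟨ cong₂ _-ℤ_ (expand (m / 2)) (expand (n / 2)) ⟩
  (r +ℤ + (m / 2) *ℤ + 2) -ℤ (r +ℤ + (n / 2) *ℤ + 2) ≡⟨ cancel r (+ (m / 2)) (+ (n / 2)) ⟩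
  (+ (m / 2) -ℤ + (n / 2)) *ℤ + 2                 ∎)
  where
  r : ℤ
  r = + (m % 2)
  expand : ∀ p → + (m % 2 + p * 2) ≡ r +ℤ + p *ℤ + 2
  expand p = trans (ℤ.pos-+ (m % 2) (p * 2)) (cong (r +ℤ_) (ℤ.pos-* p 2))
  cancel : ∀ (r p q : ℤ) → (r +ℤ p *ℤ + 2) -ℤ (r +ℤ q *ℤ + 2) ≡ (p -ℤ q) *ℤ + 2
  cancel = solve-∀

m+m≡n+n⇒m≡n : ∀ {m n} → m + m ≡ n + n → m ≡ n
m+m≡n+n⇒m≡n {m} {n} eq = ℕ.*-cancelˡ-≡ m n 2 (begin
  m + (m + 0) ≡⟨ cong (λ x → m + x) (ℕ.+-identityʳ m) ⟩
  m + m       ≡⟨ eq ⟩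
  n + n       ≡⟨ cong (λ x → n + x) (ℕ.+-identityʳ n) ⟨
  n + (n + 0) ∎)

%2≡⇒2∣m∸n : ∀ {m n} → m % 2 ≡ n % 2 → 2 ℕ.∣ m ∸ n
%2≡⇒2∣m∸n {m} {n} eq = ℕ.divides (m / 2 ∸ n / 2) (begin
  m ∸ n                                     ≡⟨ cong₂ _∸_ (m≡m%n+[m/n]*n m 2) (%2≡⇒n≡m%2+[n/2]*2 {m} {n} eq) ⟩
  (m % 2 + m / 2 * 2) ∸ (m % 2 + n / 2 * 2) ≡⟨ ℕ.[m+n]∸[m+o]≡n∸o (m % 2) _ _ ⟩
  m / 2 * 2 ∸ n / 2 * 2                     ≡⟨ ℕ.*-distribʳ-∸ 2 (m / 2) (n / 2) ⟨
  (m / 2 ∸ n / 2) * 2                       ∎)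

half-gap : ∀ {m n} → n ≤ m → m % 2 ≡ n % 2 → m ≡ ((m ∸ n) / 2 + (m ∸ n) / 2) + n
half-gap {m} {n} n≤m eq = begin
  m                                   ≡⟨ ℕ.m∸n+n≡m n≤m ⟨
  (m ∸ n) + n                         ≡⟨ cong (_+ n) (m/n*n≡m (%2≡⇒2∣m∸n {m} {n} eq)) ⟨
  (m ∸ n) / 2 * 2 + n                 ≡⟨ cong (_+ n) (ℕ.*-comm ((m ∸ n) / 2) 2) ⟩
  2 * ((m ∸ n) / 2) + n               ≡⟨ cong (λ x → ((m ∸ n) / 2 + x) + n) (ℕ.+-identityʳ _) ⟩
  ((m ∸ n) / 2 + (m ∸ n) / 2) + n     ∎

≤?-step : ∀ {n z} → n ≢ z → does (n ≤? z) ≡ does (suc n ≤? z)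
≤?-step {n} {z} n≢z with n ≤? z
... | yes n≤z = trans (dec-true (n ≤? z) n≤z) (sym (dec-true (suc n ≤? z) (ℕ.≤∧≢⇒< n≤z n≢z)))
... | no  n≰z = trans (dec-false (n ≤? z) n≰z) (sym (dec-false (suc n ≤? z) (λ n<z → n≰z (ℕ.<⇒≤ n<z))))

-- Up-down words and their heights

level : ℕ → ℕ → ℤ
level L u = + (u + u) -ℤ + L

sgn : Bool → ℤ
sgn true  = + 1
sgn false = -[1+ 0 ]

height : ∀ {L} → Vec Bool L → ℕ → ℤ
height v       zero    = + 0
height []      (suc n) = + 0
height (x ∷ v) (suc n) = sgn x +ℤ height v n

height-step : ∀ {L} (v : Vec Bool L) (i : Fin L) →
              height v (suc (toℕ i)) -ℤ height v (toℕ i) ≡ sgn (lookup v i)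
height-step (true ∷ v)  zero    = refl
height-step (false ∷ v) zero    = refl
height-step (x ∷ v)     (suc i) = trans (shift (sgn x) _ _) (height-step v i)
  where shift : ∀ (c a b : ℤ) → (c +ℤ a) -ℤ (c +ℤ b) ≡ a -ℤ b
        shift = solve-∀

height-tight : ∀ {L} (v : Vec Bool L) (i : Fin L) → ∣ height v (toℕ i) -ℤ height v (suc (toℕ i)) ∣ ≡ 1
height-tight v i = trans (ℤ.∣i-j∣≡∣j-i∣ (height v (toℕ i)) _)
                         (trans (cong ∣_∣ (height-step v i)) (∣sgn∣ (lookup v i)))
  where ∣sgn∣ : ∀ x → ∣ sgn x ∣ ≡ 1
        ∣sgn∣ true  = refl
        ∣sgn∣ false = refl

height-end : ∀ {L} (v : Vec Bool L) → height v L ≡ level L (ones v)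
height-end []          = refl
height-end {suc L} (true ∷ v) = begin
  + 1 +ℤ height v L                        ≡⟨ cong (+ 1 +ℤ_) (height-end v) ⟩
  + 1 +ℤ (+ (c + c) -ℤ + L)                ≡⟨ cong (λ z → + 1 +ℤ (z -ℤ + L)) (ℤ.pos-+ c c) ⟩
  + 1 +ℤ (+ c +ℤ + c -ℤ + L)               ≡⟨ up (+ c) (+ L) ⟩
  + suc c +ℤ + suc c -ℤ + suc L            ≡⟨ cong (_-ℤ + suc L) (ℤ.pos-+ (suc c) (suc c)) ⟨
  + (suc c + suc c) -ℤ + suc L             ∎
  where c = ones v
        up : ∀ (c l : ℤ) → + 1 +ℤ (c +ℤ c -ℤ l) ≡ (+ 1 +ℤ c) +ℤ (+ 1 +ℤ c) -ℤ (+ 1 +ℤ l)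
        up = solve-∀
height-end {suc L} (false ∷ v) =
  trans (cong (-[1+ 0 ] +ℤ_) (height-end v)) (down (+ (ones v + ones v)) (+ L))
  where down : ∀ (c l : ℤ) → -[1+ 0 ] +ℤ (c -ℤ l) ≡ c -ℤ (+ 1 +ℤ l)
        down = solve-∀

isUp : ℤ → Bool
isUp (+ 1) = true
isUp _     = false

word : ∀ L → (ℕ → ℤ) → Vec Bool L
word L φ = tabulate λ (i : Fin L) → isUp (φ (suc (toℕ i)) -ℤ φ (toℕ i))

word-height : ∀ {L} (v : Vec Bool L) → word L (height v) ≡ v
word-height v = trans (tabulate-cong λ i → trans (cong isUp (height-step v i)) (isUp-sgn (lookup v i)))
                      (tabulate∘lookup v)
  where isUp-sgn : ∀ x → isUp (sgn x) ≡ x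
        isUp-sgn true  = refl
        isUp-sgn false = refl

word-cong : ∀ L {φ ψ : ℕ → ℤ} → (∀ n → n ≤ L → φ n ≡ ψ n) → word L φ ≡ word L ψ
word-cong L eq = tabulate-cong λ i →
  cong isUp (cong₂ _-ℤ_ (eq _ (Fin.toℕ<n i)) (eq _ (ℕ.<⇒≤ (Fin.toℕ<n i))))

height-word : ∀ L (φ : ℕ → ℤ) → (∀ n → n < L → ∣ φ n -ℤ φ (suc n) ∣ ≡ 1) →
              ∀ n → n ≤ L → height (word L φ) n ≡ φ n -ℤ φ 0
height-word L       φ tight zero    _       = sym (ℤ.+-inverseʳ (φ 0))
height-word (suc L) φ tight (suc n) (s≤s n≤L) =
  trans (cong₂ _+ℤ_ (sgn-isUp (φ 1 -ℤ φ 0) (trans (ℤ.∣i-j∣≡∣j-i∣ (φ 1) (φ 0)) (tight 0 (s≤s z≤n))))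
                    (height-word L (λ k → φ (suc k)) (λ k k<L → tight (suc k) (s≤s k<L)) n n≤L))
        (telescope (φ 0) (φ 1) (φ (suc n)))
  where
  sgn-isUp : ∀ d → ∣ d ∣ ≡ 1 → sgn (isUp d) ≡ d
  sgn-isUp (+ 1)    _ = refl
  sgn-isUp -[1+ 0 ] _ = refl
  sgn-isUp (+ 0)    ()
  sgn-isUp (+ suc (suc _)) ()
  sgn-isUp -[1+ suc _ ] ()
  telescope : ∀ (a b c : ℤ) → (b -ℤ a) +ℤ (c -ℤ b) ≡ c -ℤ a
  telescope = solve-∀

level-shift : ∀ e u l → level ((e + e) + l) (e + u) ≡ level l u
level-shift e u l
  rewrite ℤ.pos-+ (e + u) (e + u) | ℤ.pos-+ e u | ℤ.pos-+ (e + e) l | ℤ.pos-+ e e | ℤ.pos-+ u u =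
  cancel (+ e) (+ u) (+ l)
  where cancel : ∀ (e u l : ℤ) → (e +ℤ u) +ℤ (e +ℤ u) -ℤ ((e +ℤ e) +ℤ l) ≡ (u +ℤ u) -ℤ l
        cancel = solve-∀

level-injective : ∀ {L u u′} → level L u ≡ level L u′ → u ≡ u′
level-injective {L} {u} {u′} eq =
  m+m≡n+n⇒m≡n (ℤ.+-injective (begin
    + (u + u)                  ≡⟨ restore _ (+ L) ⟩
    level L u +ℤ + L           ≡⟨ cong (_+ℤ + L) eq ⟩
    level L u′ +ℤ + L          ≡⟨ restore _ (+ L) ⟨
    + (u′ + u′)                ∎))
  where restore : ∀ (x l : ℤ) → x ≡ (x -ℤ l) +ℤ l
        restore = solve-∀

-- Flat steps of an integer sequence

Flat : (ℕ → ℤ) → ℕ → Set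
Flat φ n = ∣ φ n -ℤ φ (suc n) ∣ ≡ 0

isFlat : ℕ → ℕ
isFlat zero    = 1
isFlat (suc _) = 0

flats : (ℕ → ℤ) → ℕ → ℕ
flats φ zero    = 0
flats φ (suc L) = flats φ L + isFlat ∣ φ L -ℤ φ (suc L) ∣

flats-parity : ∀ L (φ : ℕ → ℤ) → (∀ n → n < L → ∣ φ n -ℤ φ (suc n) ∣ ≤ 1) →
               + 2 ∣ φ L -ℤ φ 0 +ℤ + flats φ L -ℤ + L
flats-parity zero    φ _   = divides (+ 0) (vanish (φ 0))
  where vanish : ∀ (x : ℤ) → x -ℤ x +ℤ + 0 -ℤ + 0 ≡ + 0 *ℤ + 2
        vanish = solve-∀
flats-parity (suc L) φ lip =
  subst (+ 2 ∣_) (sym (split (φ 0) (φ L) (φ (suc L)) (flats φ L) L))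
    (∣m∣n⇒∣m+n (flats-parity L φ (λ n n<L → lip n (ℕ.m≤n⇒m≤1+n n<L)))
               (step-even (φ L -ℤ φ (suc L)) (lip L ℕ.≤-refl)))
  where
  step-even : ∀ d → ∣ d ∣ ≤ 1 → + 2 ∣ (+ isFlat ∣ d ∣ -ℤ + 1 -ℤ d)
  step-even (+ 0)    _ = divides (+ 0) refl
  step-even (+ 1)    _ = divides -[1+ 0 ] refl
  step-even -[1+ 0 ] _ = divides (+ 0) refl
  step-even (+ suc (suc _)) (s≤s ())
  step-even -[1+ suc _ ] (s≤s ())
  split : ∀ φ₀ φₗ φₗ₊₁ z l →
          φₗ₊₁ -ℤ φ₀ +ℤ + (z + isFlat ∣ φₗ -ℤ φₗ₊₁ ∣) -ℤ + suc l
          ≡ (φₗ -ℤ φ₀ +ℤ + z -ℤ + l) +ℤ (+ isFlat ∣ φₗ -ℤ φₗ₊₁ ∣ -ℤ + 1 -ℤ (φₗ -ℤ φₗ₊₁))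
  split φ₀ φₗ φₗ₊₁ z l rewrite ℤ.pos-+ z (isFlat ∣ φₗ -ℤ φₗ₊₁ ∣) | ℤ.pos-+ 1 l =
    shuffle φ₀ φₗ φₗ₊₁ (+ z) (+ isFlat ∣ φₗ -ℤ φₗ₊₁ ∣) (+ l)
    where shuffle : ∀ (a b c z i l : ℤ) →
                    c -ℤ a +ℤ (z +ℤ i) -ℤ (+ 1 +ℤ l) ≡ (b -ℤ a +ℤ z -ℤ l) +ℤ (i -ℤ + 1 -ℤ (b -ℤ c))
          shuffle = solve-∀

flats≡0⇒nonflat : ∀ L (φ : ℕ → ℤ) → flats φ L ≡ 0 → ∀ n → n < L → ¬ Flat φ n
flats≡0⇒nonflat (suc L) φ none n n<1+L with ℕ.m≤n⇒m<n∨m≡n n<1+L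
... | inj₁ (s≤s n<L) = flats≡0⇒nonflat L φ (ℕ.m+n≡0⇒m≡0 _ none) n n<L
... | inj₂ refl      = λ flat → ℕ.1+n≢0 (trans (sym (cong isFlat flat)) (ℕ.m+n≡0⇒n≡0 (flats φ L) none))

flats≥1⇒flat : ∀ L (φ : ℕ → ℤ) → 1 ≤ flats φ L → ∃ λ z → z < L × Flat φ z
flats≥1⇒flat (suc L) φ some with ∣ φ L -ℤ φ (suc L) ∣ in flat
... | zero  = L , ℕ.≤-refl , flat
... | suc _ with flats≥1⇒flat L φ (subst (1 ≤_) (ℕ.+-identityʳ (flats φ L)) some)
...   | z , z<L , flatz = z , ℕ.m≤n⇒m≤1+n z<L , flatz

flats≥2⇒flat×flat : ∀ L (φ : ℕ → ℤ) → 2 ≤ flats φ L →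
                    ∃ λ z₁ → ∃ λ z₂ → z₁ < z₂ × z₂ < L × Flat φ z₁ × Flat φ z₂
flats≥2⇒flat×flat (suc L) φ two with ∣ φ L -ℤ φ (suc L) ∣ in flat
... | zero with flats≥1⇒flat L φ (ℕ.≤-pred (subst (2 ≤_) (ℕ.+-comm (flats φ L) 1) two))
...   | z , z<L , flatz = z , L , z<L , ℕ.≤-refl , flatz , flat
flats≥2⇒flat×flat (suc L) φ two | suc _
  with flats≥2⇒flat×flat L φ (subst (2 ≤_) (ℕ.+-identityʳ (flats φ L)) two)
...   | z₁ , z₂ , z₁<z₂ , z₂<L , flat₁ , flat₂ = z₁ , z₂ , z₁<z₂ , ℕ.m≤n⇒m≤1+n z₂<L , flat₁ , flat₂

-- Tight reachability

module _ (G : Graph) where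
  open Graph G

  module _ {f : V → ℤ} where
    TReach-trans : ∀ {u v w} → TReach G f u v → TReach G f v w → TReach G f u w
    TReach-trans here          q = q
    TReach-trans (fwd e t r) q = fwd e t (TReach-trans r q)
    TReach-trans (bwd e t r) q = bwd e t (TReach-trans r q)

    TReach-sym : ∀ {u v} → TReach G f u v → TReach G f v u
    TReach-sym here        = here
    TReach-sym (fwd e t r) = TReach-trans (TReach-sym r) (bwd e t here)
    TReach-sym (bwd e t r) = TReach-trans (TReach-sym r) (fwd e t here)

    TReach-invariant : (ℓ : V → Bool) → (∀ e → Tight G f e → ℓ (proj₁ (ends e)) ≡ ℓ (proj₂ (ends e))) →
                       ∀ {u v} → TReach G f u v → ℓ u ≡ ℓ v
    TReach-invariant ℓ inv here        = refl
    TReach-invariant ℓ inv (fwd e t r) = trans (inv e t) (TReach-invariant ℓ inv r)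
    TReach-invariant ℓ inv (bwd e t r) = trans (sym (inv e t)) (TReach-invariant ℓ inv r)

  N≡-from-↔ : ∀ {n} {C : Set} → Fin n ↔ C → (g : C → V → ℤ) → (∀ c → Valid G (g c)) →
              (∀ f → Valid G f → ∃ λ c → _∼_ G f (g c)) →
              (∀ c c′ → _∼_ G (g c) (g c′) → c ≡ c′) → N≡ G n
  N≡-from-↔ n↔C g valid complete injective =
    (λ i → g (to i)) , (λ i → valid (to i)) ,
    (λ f valid-f → let c , f∼gc = complete f valid-f in
                   from c , subst (λ c′ → _∼_ G f (g c′)) (sym (strictlyInverseˡ c)) f∼gc) ,
    λ i j gi∼gj → trans (sym (strictlyInverseʳ i))
                        (trans (cong from (injective _ _ gi∼gj)) (strictlyInverseʳ j))
    where open Inverse n↔C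

-- The graph CB(m)

module _ {t : ℕ} (m : Fin t → ℕ) where

  pos-inner : ∀ k (i : Fin (pred (m k))) → pos {t} {m} k (suc (toℕ i)) ≡ inner k i
  pos-inner k i with toℕ i <? pred (m k)
  ... | yes i<m = cong (inner k) (Fin.fromℕ<-toℕ i i<m)
  ... | no  i≮m = ⊥-elim (i≮m (Fin.toℕ<n i))

  pos-suc-end : ∀ k n → m k ≡ suc n → pos {t} {m} k (suc n) ≡ b
  pos-suc-end k n eq with n <? pred (m k)
  ... | yes n<n = ⊥-elim (ℕ.<-irrefl refl (subst (λ x → n < pred x) eq n<n))
  ... | no _    = refl

  pos-end : ∀ k → 1 ≤ m k → pos {t} {m} k (m k) ≡ b
  pos-end k 1≤m with m k in eq | 1≤m
  ... | suc n | _ = pos-suc-end k n eq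

  along-path : ∀ {A : Set} (F : CBV t m → A) k (g : ℕ → A) → F a ≡ g 0 → F b ≡ g (m k) →
               (∀ i → F (inner k i) ≡ g (suc (toℕ i))) → ∀ n → n ≤ m k → F (pos k n) ≡ g n
  along-path F k g ga gb ginner zero    _ = ga
  along-path F k g ga gb ginner (suc n) n<m with n <? pred (m k)
  ... | yes n<m-1 = trans (ginner (fromℕ< n<m-1)) (cong (λ i → g (suc i)) (Fin.toℕ-fromℕ< n<m-1))
  ... | no  n≮m-1 = trans gb (cong g (sym (last (m k) n<m n≮m-1)))
    where last : ∀ l → suc n ≤ l → ¬ (n < pred l) → suc n ≡ l
          last (suc l) (s≤s n≤l) n≮l = cong suc (ℕ.≤-antisym n≤l (ℕ.≮⇒≥ n≮l))

  pathLabel : (Fin t → ℕ → Bool) → Bool → Bool → CBV t m → Bool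
  pathLabel ℓ ℓa ℓb a           = ℓa
  pathLabel ℓ ℓa ℓb b           = ℓb
  pathLabel ℓ ℓa ℓb (inner k i) = ℓ k (suc (toℕ i))

  path : (CBV t m → ℤ) → Fin t → ℕ → ℤ
  path f k n = f (pos k n)

  module _ (f : CBV t m → ℤ) where

    TightStep : Fin t → ℕ → Set
    TightStep k n = ∣ path f k n -ℤ path f k (suc n) ∣ ≡ 1

    module _ (ℓ : Fin t → ℕ → Bool) {ℓa ℓb : Bool}
             (start : ∀ k → ℓ k 0 ≡ ℓa) (end : ∀ k → ℓ k (m k) ≡ ℓb) where

      pathLabel-pos : ∀ k n → n ≤ m k → pathLabel ℓ ℓa ℓb (pos k n) ≡ ℓ k n
      pathLabel-pos k = along-path (pathLabel ℓ ℓa ℓb) k (ℓ k) (sym (start k)) (sym (end k)) (λ _ → refl)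

      pathLabel-reach : (∀ k n → n < m k → TightStep k n → ℓ k n ≡ ℓ k (suc n)) →
                        ∀ {u v} → TReach (CB t m) f u v → pathLabel ℓ ℓa ℓb u ≡ pathLabel ℓ ℓa ℓb v
      pathLabel-reach step = TReach-invariant (CB t m) (pathLabel ℓ ℓa ℓb) λ { (k , i) tight →
        let i<m = Fin.toℕ<n i in
        trans (pathLabel-pos k (toℕ i) (ℕ.<⇒≤ i<m))
              (trans (step k (toℕ i) i<m tight) (sym (pathLabel-pos k (suc (toℕ i)) i<m))) }

    lipschitz-step : Lipschitz (CB t m) f → ∀ k n → n < m k → ∣ path f k n -ℤ path f k (suc n) ∣ ≤ 1
    lipschitz-step lip k n n<m =
      subst (λ i → ∣ path f k i -ℤ path f k (suc i) ∣ ≤ 1) (Fin.toℕ-fromℕ< n<m) (lip (k , fromℕ< n<m))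

    tight≢flat : ∀ {k n z} → TightStep k n → Flat (path f k) z → n ≢ z
    tight≢flat tight flat refl with trans (sym tight) flat
    ... | ()

    atMostOneFlat : TightConnected (CB t m) f → ∀ k → ¬ (2 ≤ flats (path f k) (m k))
    atMostOneFlat conn k two with flats≥2⇒flat×flat (m k) (path f k) two
    ... | z₁ , z₂ , z₁<z₂ , z₂<m , flat₁ , flat₂ = false≢true (begin
      false                               ≡⟨ pathLabel-reach ℓ start end step (conn a (pos k z₂)) ⟩
      pathLabel ℓ false false (pos k z₂)   ≡⟨ pathLabel-pos ℓ start end k z₂ (ℕ.<⇒≤ z₂<m) ⟩
      ℓ k z₂                               ≡⟨ inside-z₂ ⟩
      true                                 ∎)
      where
      inside : ℕ → Bool
      inside n = does (n ≤? z₂) ∧ not (does (n ≤? z₁))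
      ℓ : Fin t → ℕ → Bool
      ℓ k′ n = inside n ∧ does (k′ Fin.≟ k)
      start : ∀ k′ → ℓ k′ 0 ≡ false
      start k′ = refl
      end : ∀ k′ → ℓ k′ (m k′) ≡ false
      end k′ with k′ Fin.≟ k
      ... | no _    = ∧-zeroʳ _
      ... | yes refl = trans (∧-identityʳ _)
                             (cong (λ x → x ∧ not (does (m k′ ≤? z₁))) (dec-false (m k′ ≤? z₂) (ℕ.<⇒≱ z₂<m)))
      step : ∀ k′ n → n < m k′ → TightStep k′ n → ℓ k′ n ≡ ℓ k′ (suc n)
      step k′ n _ tight with k′ Fin.≟ k
      ... | no _    = trans (∧-zeroʳ _) (sym (∧-zeroʳ _))
      ... | yes refl = cong (_∧ true) (cong₂ (λ x y → x ∧ not y) (≤?-step (tight≢flat tight flat₂))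
                                                                (≤?-step (tight≢flat tight flat₁)))
      inside-z₂ : ℓ k z₂ ≡ true
      inside-z₂ = trans (cong₂ (λ x y → (x ∧ not y) ∧ does (k Fin.≟ k))
                               (dec-true (z₂ ≤? z₂) ℕ.≤-refl) (dec-false (z₂ ≤? z₁) (ℕ.<⇒≱ z₁<z₂)))
                        (dec-true (k Fin.≟ k) refl)
      false≢true : false ≢ true
      false≢true ()

    someFlatFree : TightConnected (CB t m) f → ∃ λ k → flats (path f k) (m k) ≡ 0
    someFlatFree conn with Fin.any? (λ k → flats (path f k) (m k) ℕ.≟ 0)
    ... | yes found = found
    ... | no  none  = ⊥-elim (true≢false (pathLabel-reach ℓ start end step (conn a b)))
      where
      flatAt : ∀ k → ∃ λ z → z < m k × Flat (path f k) z
      flatAt k = flats≥1⇒flat (m k) (path f k) (ℕ.n≢0⇒n>0 (λ noFlat → none (k , noFlat)))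
      ℓ : Fin t → ℕ → Bool
      ℓ k n = does (n ≤? proj₁ (flatAt k))
      start : ∀ k → ℓ k 0 ≡ true
      start k = refl
      end : ∀ k → ℓ k (m k) ≡ false
      end k = dec-false (m k ≤? _) (ℕ.<⇒≱ (proj₁ (proj₂ (flatAt k))))
      step : ∀ k n → n < m k → TightStep k n → ℓ k n ≡ ℓ k (suc n)
      step k n _ tight = ≤?-step (tight≢flat tight (proj₂ (proj₂ (flatAt k))))
      true≢false : true ≢ false
      true≢false ()

  valid⇒tight : (∀ k → 1 ≤ m k) → (∀ i j → m i % 2 ≡ m j % 2) →
                ∀ f → Valid (CB t m) f → ∀ k n → n < m k → TightStep f k n
  valid⇒tight m≥1 parity f (lip , conn) k n n<m =
    ≤1∧≢0⇒≡1 (lipschitz-step f lip k n n<m) (flats≡0⇒nonflat (m k) (path f k) (flat-free k) n n<m)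
    where
    Z : Fin t → ℕ
    Z k = flats (path f k) (m k)
    2∣gap : ∀ k → + 2 ∣ f b -ℤ f a +ℤ + Z k -ℤ + m k
    2∣gap k = subst (λ v → + 2 ∣ f v -ℤ f a +ℤ + Z k -ℤ + m k) (pos-end k (m≥1 k))
                    (flats-parity (m k) (path f k) (lipschitz-step f lip k))
    flat-free : ∀ k → Z k ≡ 0
    flat-free k with someFlatFree f conn
    ... | k₀ , Z₀≡0 = 2∣n∧n<2⇒n≡0 2∣Z (ℕ.≰⇒> (atMostOneFlat f conn k))
      where
      2∣gap₀ : + 2 ∣ f b -ℤ f a +ℤ + 0 -ℤ + m k₀
      2∣gap₀ = subst (λ z → + 2 ∣ f b -ℤ f a +ℤ + z -ℤ + m k₀) Z₀≡0 (2∣gap k₀)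
      2∣Z : + 2 ∣ + Z k
      2∣Z = subst (+ 2 ∣_) (cancel (f b -ℤ f a) (+ Z k) (+ m k) (+ m k₀))
              (∣m∣n⇒∣m+n (∣m∣n⇒∣m-n (2∣gap k) 2∣gap₀) (%2≡⇒2∣[+m]-[+n] {m k} {m k₀} (parity k k₀)))
        where cancel : ∀ (d z mₖ m₀ : ℤ) → (d +ℤ z -ℤ mₖ) -ℤ (d +ℤ + 0 -ℤ m₀) +ℤ (mₖ -ℤ m₀) ≡ z
              cancel = solve-∀

  tight⇒connected : (k₀ : Fin t) → (∀ k → 1 ≤ m k) → ∀ {f} →
                    (∀ e → Tight (CB t m) f e) → TightConnected (CB t m) f
  tight⇒connected k₀ m≥1 {f} tight u v = TReach-trans (CB t m) (to-a u) (TReach-sym (CB t m) (to-a v))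
    where
    back : ∀ k n → n < m k → TReach (CB t m) f (pos k (suc n)) (pos k n)
    back k n n<m = subst (λ i → TReach (CB t m) f (pos k (suc i)) (pos k i)) (Fin.toℕ-fromℕ< n<m)
                         (bwd (k , fromℕ< n<m) (tight (k , fromℕ< n<m)) here)
    along-to-a : ∀ k n → n ≤ m k → TReach (CB t m) f (pos k n) a
    along-to-a k zero    _   = here
    along-to-a k (suc n) n<m = TReach-trans (CB t m) (back k n n<m) (along-to-a k n (ℕ.<⇒≤ n<m))
    to-a : ∀ v → TReach (CB t m) f v a
    to-a a           = here
    to-a b           = subst (λ v → TReach (CB t m) f v a) (pos-end k₀ (m≥1 k₀))
                             (along-to-a k₀ (m k₀) ℕ.≤-refl)
    to-a (inner k i) = subst (λ v → TReach (CB t m) f v a) (pos-inner k i)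
                             (along-to-a k (suc (toℕ i)) (ℕ.≤pred⇒≤ (Fin.toℕ<n i)))

  PathWords : Set
  PathWords = (k : Fin t) → Vec Bool (m k)

  Consistent : PathWords → ℤ → Set
  Consistent ws d = ∀ k → height (ws k) (m k) ≡ d

  decode : PathWords → ℤ → CBV t m → ℤ
  decode ws d a           = + 0
  decode ws d b           = d
  decode ws d (inner k i) = height (ws k) (suc (toℕ i))

  decode-cong : ∀ {ws ws′ d d′} → (∀ k → ws k ≡ ws′ k) → d ≡ d′ → ∀ v → decode ws d v ≡ decode ws′ d′ v
  decode-cong eqs eqd a           = refl
  decode-cong eqs eqd b           = eqd
  decode-cong eqs eqd (inner k i) = cong (λ w → height w (suc (toℕ i))) (eqs k)

  module _ {ws : PathWords} {d : ℤ} (consistent : Consistent ws d) where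

    decode-path : ∀ k n → n ≤ m k → path (decode ws d) k n ≡ height (ws k) n
    decode-path k = along-path (decode ws d) k (height (ws k)) refl (sym (consistent k)) (λ _ → refl)

    decode-tight : ∀ e → Tight (CB t m) (decode ws d) e
    decode-tight (k , i) = trans (cong₂ (λ x y → ∣ x -ℤ y ∣) (decode-path k (toℕ i) (ℕ.<⇒≤ i<m))
                                                            (decode-path k (suc (toℕ i)) i<m))
                                 (height-tight (ws k) i)
      where i<m = Fin.toℕ<n i

    decode-valid : Fin t → (∀ k → 1 ≤ m k) → Valid (CB t m) (decode ws d)
    decode-valid k₀ m≥1 = (λ e → ℕ.≤-reflexive (decode-tight e)) , tight⇒connected k₀ m≥1 decode-tight

  words : (CBV t m → ℤ) → PathWords
  words f k = word (m k) (path f k)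

  words-decode : ∀ {ws d} → Consistent ws d → ∀ k → words (decode ws d) k ≡ ws k
  words-decode {ws} consistent k =
    trans (word-cong (m k) (decode-path consistent k)) (word-height (ws k))

  module _ (m≥1 : ∀ k → 1 ≤ m k) {f : CBV t m → ℤ} (tight : ∀ k n → n < m k → TightStep f k n) where

    height-words : ∀ k n → n ≤ m k → height (words f k) n ≡ path f k n -ℤ f a
    height-words k = height-word (m k) (path f k) (tight k)

    words-consistent : Consistent (words f) (f b -ℤ f a)
    words-consistent k =
      trans (height-words k (m k) ℕ.≤-refl) (cong (λ v → f v -ℤ f a) (pos-end k (m≥1 k)))

    decode-words : ∀ v → decode (words f) (f b -ℤ f a) v ≡ f v -ℤ f a
    decode-words a           = sym (ℤ.+-inverseʳ (f a))
    decode-words b           = refl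
    decode-words (inner k i) = trans (height-words k (suc (toℕ i)) (ℕ.≤pred⇒≤ (Fin.toℕ<n i)))
                                     (cong (λ v → f v -ℤ f a) (pos-inner k i))

  decode-∼ : ∀ {ws ws′ d d′} → _∼_ (CB t m) (decode ws d) (decode ws′ d′) →
             ∀ v → decode ws d v ≡ decode ws′ d′ v
  decode-∼ {ws′ = ws′} {d′ = d′} (c , shift) v = begin
    decode _ _ v            ≡⟨ shift v ⟩
    decode ws′ d′ v +ℤ c    ≡⟨ cong (decode ws′ d′ v +ℤ_) (trans (shift a) (ℤ.+-identityˡ c)) ⟨
    decode ws′ d′ v +ℤ + 0  ≡⟨ ℤ.+-identityʳ _ ⟩
    decode ws′ d′ v         ∎

  decode-injective : ∀ {ws ws′ d d′} → Consistent ws d → Consistent ws′ d′ →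
                     _∼_ (CB t m) (decode ws d) (decode ws′ d′) → (∀ k → ws k ≡ ws′ k) × d ≡ d′
  decode-injective consistent consistent′ shifted =
    (λ k → trans (sym (words-decode consistent k))
                 (trans (word-cong (m k) (λ n _ → same (pos k n))) (words-decode consistent′ k))) ,
    same b
    where same = decode-∼ shifted

  ∼-decode : (∀ k → 1 ≤ m k) → ∀ {f ws d} → (∀ k n → n < m k → TightStep f k n) →
             (∀ k → ws k ≡ words f k) → d ≡ f b -ℤ f a → _∼_ (CB t m) f (decode ws d)
  ∼-decode m≥1 {f} tight eqs eqd = f a , λ v → begin
    f v                                          ≡⟨ restore (f v) (f a) ⟩
    f v -ℤ f a +ℤ f a                            ≡⟨ cong (_+ℤ f a) (decode-words m≥1 {f} tight v) ⟨
    decode (words f) (f b -ℤ f a) v +ℤ f a       ≡⟨ cong (_+ℤ f a) (decode-cong eqs eqd v) ⟨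
    decode _ _ v +ℤ f a                          ∎
    where restore : ∀ (x y : ℤ) → x ≡ x -ℤ y +ℤ y
          restore = solve-∀

-- Counting the valid functions

module Count (s : ℕ) (m : Fin (suc s) → ℕ)
             (mono : ∀ i j → toℕ i ≤ toℕ j → m j ≤ m i)
             (parity : ∀ i j → m i % 2 ≡ m j % 2) where

  mₜ : ℕ
  mₜ = m (fromℕ s)

  offset : Fin (suc s) → ℕ
  offset k = (m k ∸ mₜ) / 2

  level-mₜ : ∀ k j → level (m k) (offset k + j) ≡ level mₜ j
  level-mₜ k j = trans (cong (λ l → level l (offset k + j)) m≡2offset+mₜ) (level-shift (offset k) j mₜ)
    where m≡2offset+mₜ = half-gap (mono k (fromℕ s) (Fin.≤fromℕ k)) (parity k (fromℕ s))

  Slot : ℕ → Fin (suc s) → Set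
  Slot j k = Words (m k) (offset k + j)

  -- j is the summation index of F: the number of up-steps on the last path.
  Config : Set
  Config = Σ≤ mₜ λ j → Tuple (suc s) (Slot j)

  F≡sum-prod : F s m ≡ sumTo mₜ (λ j → prodFin (suc s) λ k → m k C (offset k + j))
  F≡sum-prod = sumTo-cong mₜ λ j → begin
    (mₜ C j) * front j                  ≡⟨ ℕ.*-comm (mₜ C j) (front j) ⟩
    front j * (mₜ C j)                  ≡⟨ cong (λ x → front j * (mₜ C (x / 2 + j))) (ℕ.n∸n≡0 mₜ) ⟨
    front j * (mₜ C (offset (fromℕ s) + j))  ≡⟨ prodFin-last s (λ k → m k C (offset k + j)) ⟨
    prodFin (suc s) (λ k → m k C (offset k + j)) ∎
    where front : ℕ → ℕ
          front j = prodFin s (λ k → m (inject₁ k) C (offset (inject₁ k) + j))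

  F↔Config : Fin (F s m) ↔ Config
  F↔Config = subst (λ n → Fin n ↔ Config) (sym F≡sum-prod)
    (↔-trans (sumTo↔Σ≤ mₜ _) (Σ≤-↔ mₜ λ j →
      ↔-trans (prodFin↔Tuple (suc s) (λ k → m k C (offset k + j)))
              (Tuple-↔ (suc s) {B = Slot j} λ k → C↔Words (m k) (offset k + j))))

  family : Config → PathWords m
  family (j , _ , ws) k = proj₁ (lookupᵗ {A = Slot j} ws k)

  endHeight : Config → ℤ
  endHeight (j , _) = level mₜ j

  family-consistent : ∀ c → Consistent m (family c) (endHeight c)
  family-consistent (j , _ , ws) k =
    trans (height-end (proj₁ w)) (trans (cong (level (m k)) (proj₂ w)) (level-mₜ k j))
    where w : Slot j k
          w = lookupᵗ {A = Slot j} ws k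

  module _ (ws : PathWords m) {d : ℤ} (consistent : Consistent m ws d) where

    private
      j : ℕ
      j = ones (ws (fromℕ s))

      ones≡ : ∀ k → ones (ws k) ≡ offset k + j
      ones≡ k = level-injective {m k} {ones (ws k)} {offset k + j} (begin
        level (m k) (ones (ws k))   ≡⟨ height-end (ws k) ⟨
        height (ws k) (m k)         ≡⟨ trans (consistent k) (sym (consistent (fromℕ s))) ⟩
        height (ws (fromℕ s)) mₜ   ≡⟨ height-end (ws (fromℕ s)) ⟩
        level mₜ j                  ≡⟨ level-mₜ k j ⟨
        level (m k) (offset k + j)       ∎)

    config : Config
    config = j , ones≤length (ws (fromℕ s)) , tabulateᵗ (suc s) {Slot j} λ k → ws k , ones≡ k

    family-config : ∀ k → family config k ≡ ws k
    family-config k = cong proj₁ (lookup-tabulateᵗ (suc s) {Slot j} (λ k → ws k , ones≡ k) k)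

    endHeight-config : endHeight config ≡ d
    endHeight-config = trans (sym (height-end (ws (fromℕ s)))) (consistent (fromℕ s))

  family-injective : ∀ c c′ → (∀ k → family c k ≡ family c′ k) → endHeight c ≡ endHeight c′ → c ≡ c′
  family-injective (j , j≤ , ws) (j′ , j′≤ , ws′) same-family same-end
    with level-injective {mₜ} {j} {j′} same-end
  ... | refl = cong₂ (λ p xs → j , p , xs) (ℕ.≤-irrelevant j≤ j′≤)
                     (Tuple-ext (suc s) {Slot j} λ k → Words-≡ (same-family k))

proposition4p5 : (s : ℕ) (m : Fin (suc s) → ℕ) →
    ((k : Fin (suc s)) → 1 ≤ m k) →
    ((i j : Fin (suc s)) → toℕ i ≤ toℕ j → m j ≤ m i) →
    ((i j : Fin (suc s)) → m i % 2 ≡ m j % 2) →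
    N≡ (CB (suc s) m) (F s m)
proposition4p5 s m m≥1 mono parity = N≡-from-↔ (CB (suc s) m) F↔Config g valid complete injective
  where
  open Count s m mono parity
  g : Config → CBV (suc s) m → ℤ
  g c = decode m (family c) (endHeight c)
  valid : ∀ c → Valid (CB (suc s) m) (g c)
  valid c = decode-valid m (family-consistent c) zero m≥1
  complete : ∀ f → Valid (CB (suc s) m) f → ∃ λ c → _∼_ (CB (suc s) m) f (g c)
  complete f valid-f =
    config (words m f) consistent ,
    ∼-decode m m≥1 tight (family-config (words m f) consistent) (endHeight-config (words m f) consistent)
    where
    tight : ∀ k n → n < m k → TightStep m f k n
    tight = valid⇒tight m m≥1 parity f valid-f
    consistent : Consistent m (words m f) (f b -ℤ f a)
    consistent = words-consistent m m≥1 {f} tight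
  injective : ∀ c c′ → _∼_ (CB (suc s) m) (g c) (g c′) → c ≡ c′
  injective c c′ shifted =
    let same-family , same-end = decode-injective m (family-consistent c) (family-consistent c′) shifted
    in family-injective c c′ same-family same-end
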